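{- For any term $M$, type $A$, variable $x$ and type $C$, it is not the case that both $\Gamma_1;\Omega_1;(\Delta_1,x{:}C)\vdash M:A$ and $\Gamma_2;(\Omega_2,x{:}C);\Delta_2\vdash M:A$ hold.
   Context: Strict $\lambda$-calculus over a signature $\Sigma$. Labels $k\in\{1,0,u\}$; types $A::=a\mid A_1\to^kA_2$; terms $c\mid x\mid\lambda x^k{:}A.M\mid M_1M_2^k$. Contexts: finite sets of declarations with distinct variables; commas denote disjoint unions. Typing $\Gamma;\Omega;\Delta\vdash M:A$ ($\Gamma$ unrestricted, $\Omega$ irrelevant, $\Delta$ strict; pairwise disjoint): if $c{:}A\in\Sigma$ then $\Gamma;\Omega;\cdot\vdash c:A$; $(\Gamma,x{:}A);\Omega;\cdot\vdash x:A$; $\Gamma;\Omega;x{:}A\vdash x:A$ (no rule for $\Omega$); from $(\Gamma,x{:}A);\Omega;\Delta\vdash M:B$ infer $\Gamma;\Omega;\Delta\vdash\lambda x^u{:}A.M:A\to^uB$; from $\Gamma;(\Omega,x{:}A);\Delta\vdash M:B$ infer $\Gamma;\Omega;\Delta\vdash\lambda x^0{:}A.M:A\to^0B$; from $\Gamma;\Omega;(\Delta,x{:}A)\vdash M:B$ infer $\Gamma;\Omega;\Delta\vdash\lambda x^1{:}A.M:A\to^1B$; from $\Gamma;\Omega;\Delta\vdash M:A\to^uB$ and $(\Gamma,\Delta);\Omega;\cdot\vdash N:A$ infer $\Gamma;\Omega;\Delta\vdash MN^u:B$; from $\Gamma;\Omega;\Delta\vdash M:A\to^0B$ and $(\Gamma,\Omega,\Delta);\cdot;\cdot\vdash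 N:A$ infer $\Gamma;\Omega;\Delta\vdash MN^0:B$; from $(\Gamma,\Delta_N);\Omega;\Delta_M\vdash M:A\to^1B$ and $(\Gamma,\Delta_M);\Omega;\Delta_N\vdash N:A$ infer $\Gamma;\Omega;(\Delta_M,\Delta_N)\vdash MN^1:B$. -}

module Defs where

open import Data.Nat using (ℕ)
open import Data.Product using (_×_; _,_; proj₁)
open import Data.List using (List; []; _∷_; _++_; map)
open import Data.List.Membership.Propositional using (_∈_)
open import Data.List.Relation.Unary.Unique.Propositional using (Unique)
open import Data.List.Relation.Binary.Permutation.Propositional using (_↭_)

Var : Set
Var = ℕ

Const : Set
Const = ℕ

BaseTy : Set
BaseTy = ℕ

data Label : Set where
  one zero u : Label

data Ty : Set where
  base : BaseTy → Ty
  _⇒[_]_ : Ty → Label → Ty → Ty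

data Tm : Set where
  con : Const → Tm
  var : Var → Tm
  lam : Var → Label → Ty → Tm → Tm
  app : Tm → Tm → Label → Tm

-- Contexts: lists of declarations, read as finite sets (all rules only
-- use membership / permutation, and distinctness of variables is imposed
-- by WF).
Ctx : Set
Ctx = List (Var × Ty)

Sig : Set
Sig = List (Const × Ty)

WF : Ctx → Ctx → Ctx → Set
WF Γ Ω Δ = Unique (map proj₁ (Γ ++ Ω ++ Δ))

-- Typing  Γ;Ω;Δ ⊢ M : A  over the signature Σ.
-- Well-formedness (pairwise disjoint contexts with distinct variables) is
-- required at the leaves; it then holds for every derivable judgment.
data _⊢_⨾_⨾_⊢_∶_ (Σ : Sig) : Ctx → Ctx → Ctx → Tm → Ty → Set where
  t-con : ∀ {Γ Ω c A} → WF Γ Ω [] → (c , A) ∈ Σ →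
          Σ ⊢ Γ ⨾ Ω ⨾ [] ⊢ con c ∶ A
  t-uvar : ∀ {Γ Ω x A} → WF Γ Ω [] → (x , A) ∈ Γ →
           Σ ⊢ Γ ⨾ Ω ⨾ [] ⊢ var x ∶ A
  t-svar : ∀ {Γ Ω x A} → WF Γ Ω ((x , A) ∷ []) →
           Σ ⊢ Γ ⨾ Ω ⨾ ((x , A) ∷ []) ⊢ var x ∶ A
  t-lamu : ∀ {Γ Ω Δ x A M B} →
           Σ ⊢ ((x , A) ∷ Γ) ⨾ Ω ⨾ Δ ⊢ M ∶ B →
           Σ ⊢ Γ ⨾ Ω ⨾ Δ ⊢ lam x u A M ∶ (A ⇒[ u ] B)
  t-lam0 : ∀ {Γ Ω Δ x A M B} →
           Σ ⊢ Γ ⨾ ((x , A) ∷ Ω) ⨾ Δ ⊢ M ∶ B →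
           Σ ⊢ Γ ⨾ Ω ⨾ Δ ⊢ lam x zero A M ∶ (A ⇒[ zero ] B)
  t-lam1 : ∀ {Γ Ω Δ x A M B} →
           Σ ⊢ Γ ⨾ Ω ⨾ ((x , A) ∷ Δ) ⊢ M ∶ B →
           Σ ⊢ Γ ⨾ Ω ⨾ Δ ⊢ lam x one A M ∶ (A ⇒[ one ] B)
  t-appu : ∀ {Γ Ω Δ M N A B} →
           Σ ⊢ Γ ⨾ Ω ⨾ Δ ⊢ M ∶ (A ⇒[ u ] B) →
           Σ ⊢ (Γ ++ Δ) ⨾ Ω ⨾ [] ⊢ N ∶ A →
           Σ ⊢ Γ ⨾ Ω ⨾ Δ ⊢ app M N u ∶ B
  t-app0 : ∀ {Γ Ω Δ M N A B} →
           Σ ⊢ Γ ⨾ Ω ⨾ Δ ⊢ M ∶ (A ⇒[ zero ] B) →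
           Σ ⊢ (Γ ++ Ω ++ Δ) ⨾ [] ⨾ [] ⊢ N ∶ A →
           Σ ⊢ Γ ⨾ Ω ⨾ Δ ⊢ app M N zero ∶ B
  t-app1 : ∀ {Γ Ω Δ ΔM ΔN M N A B} →
           Δ ↭ (ΔM ++ ΔN) →
           Σ ⊢ (Γ ++ ΔN) ⨾ Ω ⨾ ΔM ⊢ M ∶ (A ⇒[ one ] B) →
           Σ ⊢ (Γ ++ ΔM) ⨾ Ω ⨾ ΔN ⊢ N ∶ A →
           Σ ⊢ Γ ⨾ Ω ⨾ Δ ⊢ app M N one ∶ B

{-# OPTIONS --safe #-}
module Submission where

open import Defs
open import Data.Product using (_×_; _,_; proj₁)
open import Data.Sum using (_⊎_; inj₁; inj₂)
open import Data.Empty using (⊥)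
open import Data.List using (List; []; _∷_; _++_; map)
open import Data.List.Properties using (map-++)
open import Data.List.Relation.Unary.Any using (here; there)
open import Data.List.Relation.Unary.All using (lookup)
open import Data.List.Relation.Unary.AllPairs using (_∷_)
open import Data.List.Relation.Unary.Unique.Propositional using (Unique)
open import Data.List.Relation.Binary.Disjoint.Propositional using (Disjoint)
open import Data.List.Relation.Binary.Permutation.Propositional using (_↭_)
open import Data.List.Relation.Binary.Permutation.Propositional.Properties using (∈-resp-↭; map⁺)
open import Data.List.Membership.Propositional using (_∈_)
open import Data.List.Membership.Propositional.Properties using (∈-map⁺; ∈-++⁺ˡ; ∈-++⁺ʳ; ∈-++⁻)
open import Relation.Binary.PropositionalEquality using (_≡_; refl; cong; trans; subst)
open import Relation.Nullary using (¬_)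

-- Call x a strict occurrence in M if it is reachable from the root of M
-- without entering the argument of an unrestricted or irrelevant application.
-- A strict hypothesis must occur strictly: the rules only ever pass it on to
-- a function part or to one side of a strict application, until it is used
-- by the strict variable rule.  An irrelevant hypothesis never occurs
-- strictly: outside arguments of irrelevant applications (where it turns
-- unrestricted) it stays irrelevant, and well-formedness at the variable
-- leaves keeps it apart from the variable being used.

module _ {a} {A : Set a} where

  unique-++⇒disjoint : {xs ys : List A} → Unique (xs ++ ys) → Disjoint xs ys
  unique-++⇒disjoint {_ ∷ xs} (x∉xs++ys ∷ _)  (here refl , v∈ys) =
    lookup x∉xs++ys (∈-++⁺ʳ xs v∈ys) refl
  unique-++⇒disjoint {_ ∷ _}  (_ ∷ xs++ys!) (there v∈xs , v∈ys) =
    unique-++⇒disjoint xs++ys! (v∈xs , v∈ys)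

  unique-++⁻ʳ : (xs : List A) {ys : List A} → Unique (xs ++ ys) → Unique ys
  unique-++⁻ʳ []       ys!            = ys!
  unique-++⁻ʳ (_ ∷ xs) (_ ∷ xs++ys!) = unique-++⁻ʳ xs xs++ys!

dom : Ctx → List Var
dom = map proj₁

∈-dom-↭-++⁻ : ∀ {x Δ Δ₁ Δ₂} → Δ ↭ Δ₁ ++ Δ₂ → x ∈ dom Δ → x ∈ dom Δ₁ ⊎ x ∈ dom Δ₂
∈-dom-↭-++⁻ {Δ₁ = Δ₁} {Δ₂} Δ↭ x∈Δ =
  ∈-++⁻ (dom Δ₁) (subst (_ ∈_) (map-++ proj₁ Δ₁ Δ₂) (∈-resp-↭ (map⁺ proj₁ Δ↭) x∈Δ))

WF⇒unique-dom : ∀ Γ Ω Δ → WF Γ Ω Δ → Unique (dom Γ ++ dom Ω ++ dom Δ)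
WF⇒unique-dom Γ Ω Δ = subst Unique dom-++-++
  where
  dom-++-++ : dom (Γ ++ Ω ++ Δ) ≡ dom Γ ++ dom Ω ++ dom Δ
  dom-++-++ = trans (map-++ proj₁ Γ (Ω ++ Δ)) (cong (dom Γ ++_) (map-++ proj₁ Ω Δ))

WF⇒disjoint-ΓΩ : ∀ Γ Ω Δ → WF Γ Ω Δ → Disjoint (dom Γ) (dom Ω)
WF⇒disjoint-ΓΩ Γ Ω Δ w (v∈Γ , v∈Ω) =
  unique-++⇒disjoint (WF⇒unique-dom Γ Ω Δ w) (v∈Γ , ∈-++⁺ˡ v∈Ω)

WF⇒disjoint-ΩΔ : ∀ Γ Ω Δ → WF Γ Ω Δ → Disjoint (dom Ω) (dom Δ)
WF⇒disjoint-ΩΔ Γ Ω Δ w = unique-++⇒disjoint (unique-++⁻ʳ (dom Γ) (WF⇒unique-dom Γ Ω Δ w))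

-- Binders are not subtracted: a λ only extends the contexts, and a rebound x
-- would violate well-formedness at every leaf below it.
OccursStrictly : Var → Tm → Set
OccursStrictly x (con _)        = ⊥
OccursStrictly x (var y)        = y ≡ x
OccursStrictly x (lam _ _ _ M)  = OccursStrictly x M
OccursStrictly x (app M N one)  = OccursStrictly x M ⊎ OccursStrictly x N
OccursStrictly x (app M _ zero) = OccursStrictly x M
OccursStrictly x (app M _ u)    = OccursStrictly x M

strict⇒occursStrictly : ∀ {Σ Γ Ω Δ M A x} →
  Σ ⊢ Γ ⨾ Ω ⨾ Δ ⊢ M ∶ A → x ∈ dom Δ → OccursStrictly x M
strict⇒occursStrictly (t-svar _)     (here refl) = refl
strict⇒occursStrictly (t-lamu ⊢M)    x∈Δ = strict⇒occursStrictly ⊢M x∈Δ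
strict⇒occursStrictly (t-lam0 ⊢M)    x∈Δ = strict⇒occursStrictly ⊢M x∈Δ
strict⇒occursStrictly (t-lam1 ⊢M)    x∈Δ = strict⇒occursStrictly ⊢M (there x∈Δ)
strict⇒occursStrictly (t-appu ⊢M _)  x∈Δ = strict⇒occursStrictly ⊢M x∈Δ
strict⇒occursStrictly (t-app0 ⊢M _)  x∈Δ = strict⇒occursStrictly ⊢M x∈Δ
strict⇒occursStrictly (t-app1 Δ↭ ⊢M ⊢N) x∈Δ with ∈-dom-↭-++⁻ Δ↭ x∈Δ
... | inj₁ x∈ΔM = inj₁ (strict⇒occursStrictly ⊢M x∈ΔM)
... | inj₂ x∈ΔN = inj₂ (strict⇒occursStrictly ⊢N x∈ΔN)

irrelevant⇒¬occursStrictly : ∀ {Σ Γ Ω Δ M A x} →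
  Σ ⊢ Γ ⨾ Ω ⨾ Δ ⊢ M ∶ A → x ∈ dom Ω → ¬ OccursStrictly x M
irrelevant⇒¬occursStrictly (t-uvar {Γ} {Ω} wf y∈Γ) x∈Ω refl =
  WF⇒disjoint-ΓΩ Γ Ω [] wf (∈-map⁺ proj₁ y∈Γ , x∈Ω)
irrelevant⇒¬occursStrictly (t-svar {Γ} {Ω} wf)  x∈Ω refl =
  WF⇒disjoint-ΩΔ Γ Ω _ wf (x∈Ω , here refl)
irrelevant⇒¬occursStrictly (t-lamu ⊢M)    x∈Ω = irrelevant⇒¬occursStrictly ⊢M x∈Ω
irrelevant⇒¬occursStrictly (t-lam0 ⊢M)    x∈Ω = irrelevant⇒¬occursStrictly ⊢M (there x∈Ω)
irrelevant⇒¬occursStrictly (t-lam1 ⊢M)    x∈Ω = irrelevant⇒¬occursStrictly ⊢M x∈Ω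
irrelevant⇒¬occursStrictly (t-appu ⊢M _)  x∈Ω = irrelevant⇒¬occursStrictly ⊢M x∈Ω
irrelevant⇒¬occursStrictly (t-app0 ⊢M _)  x∈Ω = irrelevant⇒¬occursStrictly ⊢M x∈Ω
irrelevant⇒¬occursStrictly (t-app1 _ ⊢M _) x∈Ω (inj₁ occ) = irrelevant⇒¬occursStrictly ⊢M x∈Ω occ
irrelevant⇒¬occursStrictly (t-app1 _ _ ⊢N) x∈Ω (inj₂ occ) = irrelevant⇒¬occursStrictly ⊢N x∈Ω occ

lemma3p7 : (Σ : Sig) (Γ₁ Ω₁ Δ₁ Γ₂ Ω₂ Δ₂ : Ctx) (M : Tm) (A : Ty) (x : Var) (C : Ty) →
    ¬ ((Σ ⊢ Γ₁ ⨾ Ω₁ ⨾ ((x , C) ∷ Δ₁) ⊢ M ∶ A) × (Σ ⊢ Γ₂ ⨾ ((x , C) ∷ Ω₂) ⨾ Δ₂ ⊢ M ∶ A))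
lemma3p7 Σ Γ₁ Ω₁ Δ₁ Γ₂ Ω₂ Δ₂ M A x C (x-strict , x-irrelevant) =
  irrelevant⇒¬occursStrictly x-irrelevant (here refl) (strict⇒occursStrictly x-strict (here refl))
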